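{- For every integer $n \geq 3$, Left wins the Classic Variant of the Mixed Deletion Game played on the complete graph $K_n$.
   Context: The Classic Variant of the Mixed Deletion Game is a two-player combinatorial game between Left and Right played on a finite simple undirected graph; players alternate turns. On her turn Left deletes one vertex together with all edges incident to it; on his turn Right deletes one edge. The game ends when a deletion creates an isolated vertex (a vertex of degree $0$), and the player whose deletion created an isolated vertex loses; thus a legal move is a deletion which does not create an isolated vertex, and a player with no legal move loses. $K_n$ denotes the complete graph on $n$ vertices. -}

module Defs where

open import Data.Nat using (ℕ)
open import Data.Fin using (Fin; _≟_)
open import Data.Bool using (Bool; true; false; _∧_; _∨_; not)
open import Data.Product using (_×_)
open import Relation.Nullary using (¬_; does)
open import Relation.Binary.PropositionalEquality using (_≡_)

-- A game position: a simple graph whose vertices are a subset of Fin n.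
-- The edge {x,y} is present iff x ≢ y, both endpoints are present and
-- edge x y ≡ true  (edge is kept symmetric by all operations below).
record Graph (n : ℕ) : Set where
  field
    present : Fin n → Bool
    edge    : Fin n → Fin n → Bool
open Graph public

Adj : {n : ℕ} → Graph n → Fin n → Fin n → Set
Adj G x y = present G x ≡ true × present G y ≡ true × ¬ (x ≡ y) × edge G x y ≡ true

Isolated : {n : ℕ} → Graph n → Fin n → Set
Isolated G v = present G v ≡ true × (∀ w → ¬ Adj G v w)

NoIsolated : {n : ℕ} → Graph n → Set
NoIsolated G = ∀ v → ¬ Isolated G v

K : (n : ℕ) → Graph n
K n = record { present = λ _ → true ; edge = λ _ _ → true }

deleteVertex : {n : ℕ} → Graph n → Fin n → Graph n
deleteVertex G v = record
  { present = λ x → present G x ∧ not (does (x ≟ v))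
  ; edge    = edge G }

deleteEdge : {n : ℕ} → Graph n → Fin n → Fin n → Graph n
deleteEdge G u v = record
  { present = present G
  ; edge    = λ x y → edge G x y ∧ not ((does (x ≟ u) ∧ does (y ≟ v)) ∨ (does (x ≟ v) ∧ does (y ≟ u))) }

-- Classic variant: a move is legal iff it does not create an isolated vertex
-- (positions reached in play from K_n, n ≥ 2, never contain isolated vertices,
-- so "creates no isolated vertex" = "the resulting graph has no isolated vertex").
-- A player with no legal move loses.
--
-- LeftWinsRightToMove G : Right to move on G, Left has a winning strategy.
-- (Inductive, so plays are finite; they are, since each move deletes something.)
data LeftWinsLeftToMove  {n : ℕ} (G : Graph n) : Set
data LeftWinsRightToMove {n : ℕ} (G : Graph n) : Set

data LeftWinsLeftToMove {n} G where
  leftMove : (v : Fin n) → present G v ≡ true →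
             NoIsolated (deleteVertex G v) →
             LeftWinsRightToMove (deleteVertex G v) →
             LeftWinsLeftToMove G

data LeftWinsRightToMove {n} G where
  rightMoves : (∀ u v → Adj G u v →
                 NoIsolated (deleteEdge G u v) →
                 LeftWinsLeftToMove (deleteEdge G u v)) →
               LeftWinsRightToMove G

-- "Left wins G" in the combinatorial-game sense (outcome class L):
-- Left wins whether she moves first or second.
LeftWins : {n : ℕ} → Graph n → Set
LeftWins G = LeftWinsLeftToMove G × LeftWinsRightToMove G

-- Left keeps the position complete. Whenever Right deletes an edge uv, Left deletes u: what
-- remains is again complete, and it still has two vertices (so no isolated one), because
-- Right's move was legal only if u kept a neighbour t ≠ v. Every round removes a vertex, so
-- Right eventually runs out of legal moves. Opening on K_n, Left deletes a vertex and leaves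
-- K_{n-1}, which has no isolated vertex since n ≥ 3.
module Submission where

open import Defs
open import Data.Nat using (ℕ; zero; suc; _≤_; s≤s; z≤n)
open import Data.Nat.Properties using (suc-injective; 1+n≢0)
import Data.Fin.Properties as Fin
open import Data.Fin using (Fin; _≟_) renaming (zero to fz; suc to fs)
open import Data.Bool using (Bool; true; false; if_then_else_)
open import Data.Bool.Properties using (∧-identityʳ; ∧-zeroʳ; not-¬)
open import Data.Product using (_×_; _,_)
open import Data.Empty using (⊥-elim)
open import Function using (_∘_)
open import Relation.Nullary using (does; yes; no)
open import Relation.Nullary.Decidable using (dec-true; dec-false)
open import Relation.Binary.PropositionalEquality using (_≡_; _≢_; refl; sym; trans; cong)

count : ∀ {n} → (Fin n → Bool) → ℕ
count {zero}  p = 0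
count {suc n} p = if p fz then suc (count (p ∘ fs)) else count (p ∘ fs)

count-cong : ∀ {n} {p q : Fin n → Bool} → (∀ x → p x ≡ q x) → count p ≡ count q
count-cong {zero}          eq = refl
count-cong {suc n} {p} {q} eq rewrite eq fz | count-cong {p = p ∘ fs} {q ∘ fs} (eq ∘ fs) = refl

count-drop : ∀ {n} {p q : Fin n → Bool} {u : Fin n} → p u ≡ true → q u ≡ false →
             (∀ x → x ≢ u → q x ≡ p x) → count p ≡ suc (count q)
count-drop {suc n} {p} {q} {fz} pu qu agree rewrite pu | qu =
  cong suc (count-cong (λ x → sym (agree (fs x) λ ())))
count-drop {suc n} {p} {q} {fs u} pu qu agree rewrite agree fz (λ ()) =
  if-suc (p fz) (count-drop {p = p ∘ fs} {q ∘ fs} pu qu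
                 (λ x x≢u → agree (fs x) (x≢u ∘ Fin.suc-injective)))
  where
  if-suc : ∀ b {k l} → k ≡ suc l → (if b then suc k else k) ≡ suc (if b then suc l else l)
  if-suc true  eq = cong suc eq
  if-suc false eq = eq

size : ∀ {n} → Graph n → ℕ
size G = count (present G)

module _ {n : ℕ} {G : Graph n} where

  present-deleteVertex-≢ : ∀ {v x} → x ≢ v → present (deleteVertex G v) x ≡ present G x
  present-deleteVertex-≢ {v} {x} x≢v rewrite dec-false (x ≟ v) x≢v = ∧-identityʳ (present G x)

  present-deleteVertex-self : ∀ v → present (deleteVertex G v) v ≡ false
  present-deleteVertex-self v rewrite dec-true (v ≟ v) refl = ∧-zeroʳ (present G v)

  present-deleteVertex⁺ : ∀ {v x} → present G x ≡ true → x ≢ v → present (deleteVertex G v) x ≡ true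
  present-deleteVertex⁺ px x≢v = trans (present-deleteVertex-≢ x≢v) px

  present-deleteVertex⁻ : ∀ {v x} → present (deleteVertex G v) x ≡ true → present G x ≡ true × x ≢ v
  present-deleteVertex⁻ {v} {x} px = trans (sym (present-deleteVertex-≢ x≢v)) px , x≢v
    where
    x≢v : x ≢ v
    x≢v refl = not-¬ (present-deleteVertex-self v) px

  size-deleteVertex : ∀ {v} → present G v ≡ true → size G ≡ suc (size (deleteVertex G v))
  size-deleteVertex {v} pv = count-drop pv (present-deleteVertex-self v) (λ _ → present-deleteVertex-≢)

  edge-deleteEdge-≢ : ∀ {u v x y} → x ≢ u → y ≢ u → edge (deleteEdge G u v) x y ≡ edge G x y
  edge-deleteEdge-≢ {u} {v} {x} {y} x≢u y≢u
    rewrite dec-false (x ≟ u) x≢u | dec-false (y ≟ u) y≢u | ∧-zeroʳ (does (x ≟ v)) =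
    ∧-identityʳ (edge G x y)

  edge-deleteEdge-self : ∀ u v → edge (deleteEdge G u v) u v ≡ false
  edge-deleteEdge-self u v rewrite dec-true (u ≟ u) refl | dec-true (v ≟ v) refl = ∧-zeroʳ (edge G u v)

Clique : ∀ {n} → Graph n → Set
Clique G = ∀ {x y} → present G x ≡ true → present G y ≡ true → x ≢ y → edge G x y ≡ true

isolated-clique-unique : ∀ {n} {G : Graph n} → Clique G →
                         ∀ {w x} → Isolated G w → present G x ≡ true → x ≡ w
isolated-clique-unique clique {w} {x} (pw , isolated) px with x ≟ w
... | yes x≡w = x≡w
... | no x≢w  = ⊥-elim (isolated x (pw , px , x≢w ∘ sym , clique pw px (x≢w ∘ sym)))

noIsolated-clique : ∀ {n} {G : Graph n} → Clique G →
                    ∀ {a b} → present G a ≡ true → present G b ≡ true → a ≢ b → NoIsolated G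
noIsolated-clique clique pa pb a≢b w isolated =
  a≢b (trans (isolated-clique-unique clique isolated pa)
             (sym (isolated-clique-unique clique isolated pb)))

module _ {n : ℕ} {G : Graph n} (clique : Clique G) where

  clique-deleteEdge-deleteVertex : ∀ u v → Clique (deleteVertex (deleteEdge G u v) u)
  clique-deleteEdge-deleteVertex u v px py x≢y
    with present-deleteVertex⁻ {G = G} px | present-deleteVertex⁻ {G = G} py
  ... | px′ , x≢u | py′ , y≢u = trans (edge-deleteEdge-≢ {G = G} x≢u y≢u) (clique px′ py′ x≢y)

  noIsolated-deleteEdge-deleteVertex : ∀ {u v} → Adj G u v → NoIsolated (deleteEdge G u v) →
                                       NoIsolated (deleteVertex (deleteEdge G u v) u)
  noIsolated-deleteEdge-deleteVertex {u} {v} (pu , pv , u≢v , _) noIsolated w isolated =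
    noIsolated u (pu , λ { t (_ , pt , u≢t , eut) →
      t≢v eut (survivors-equal pt (u≢t ∘ sym) pv (u≢v ∘ sym)) })
    where
    survivors-equal : ∀ {x y} → present G x ≡ true → x ≢ u → present G y ≡ true → y ≢ u → x ≡ y
    survivors-equal px x≢u py y≢u =
      trans (unique (present-deleteVertex⁺ {G = deleteEdge G u v} px x≢u))
            (sym (unique (present-deleteVertex⁺ {G = deleteEdge G u v} py y≢u)))
      where
      unique : ∀ {z} → present (deleteVertex (deleteEdge G u v) u) z ≡ true → z ≡ w
      unique = isolated-clique-unique (clique-deleteEdge-deleteVertex u v) isolated
    t≢v : ∀ {t} → edge (deleteEdge G u v) u t ≡ true → t ≢ v
    t≢v eut refl = not-¬ (edge-deleteEdge-self {G = G} u v) eut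

leftWinsRightToMove-clique : ∀ {n} {G : Graph n} → Clique G → LeftWinsRightToMove G
leftWinsRightToMove-clique {G = G} = go (size G) refl
  where
  go : ∀ {n} k {G : Graph n} → size G ≡ k → Clique G → LeftWinsRightToMove G
  go zero {G} size≡0 _ = rightMoves λ { u v (pu , _) _ →
    ⊥-elim (1+n≢0 (trans (sym (size-deleteVertex {G = G} pu)) size≡0)) }
  go (suc k) {G} size≡1+k clique = rightMoves λ { u v adj@(pu , _) noIsolated →
    leftMove u pu (noIsolated-deleteEdge-deleteVertex clique adj noIsolated)
      (go k (suc-injective (trans (sym (size-deleteVertex {G = G} pu)) size≡1+k))
            (clique-deleteEdge-deleteVertex clique u v)) }

theorem3p7 : (n : ℕ) → 3 ≤ n → LeftWins (K n)
theorem3p7 (suc (suc (suc m))) (s≤s (s≤s (s≤s z≤n))) =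
  leftMove fz refl (noIsolated-clique K-fz-clique {a = fs fz} {b = fs (fs fz)} refl refl (λ ()))
           (leftWinsRightToMove-clique K-fz-clique) ,
  leftWinsRightToMove-clique (λ _ _ _ → refl)
  where
  K-fz-clique : Clique (deleteVertex (K (suc (suc (suc m)))) fz)
  K-fz-clique _ _ _ = refl
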